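{- Let $G$ be a connected $K^3_3$-saturated graph of order $n\geq 6$, and let $v\in V(G)$ with $d(v)=\delta(G)=2$. Then $v$ is a type-I, type-II, type-III, or type-IV vertex.
   Context: All graphs are finite and simple; $d(v)$ is the degree, $N(v)$ the neighborhood, $\delta(G)$ the minimum degree. The virus $K^3_3$ is the graph on $6$ vertices obtained from a triangle by attaching one pendant vertex to each of its three vertices. A graph $G$ is $K^3_3$-saturated if it contains no subgraph isomorphic to $K^3_3$ but $G+uv$ contains one for every pair of non-adjacent vertices $u,v$; a graph with fewer than $6$ vertices is not $K^3_3$-saturated by convention. Let $v$ have $d(v)=2$ and $N(v)=\{v_1,v_2\}$ (for some labeling of its two neighbors). $v$ is a type-I vertex if $d(v_1)=2$, there is $v_3\in N(v_1)\setminus\{v\}$ with $v_3v_2\in E(G)$, $d(v_2)\ge3$ and $d(v_3)\ge3$; a type-II vertex if $d(v_1)=2$, $N(v_1)=\{v,v_2\}$ and $d(v_2)\ge3$; a type-III vertex if $d(v_1)\ge3$, $d(v_2)\ge3$ and $v_1v_2\notin E(G)$; a type-IV vertex if $d(v_1)\ge3$, $d(v_2)\ge3$, $v_1v_2\in E(G)$, and there exist two distinct vertices $v_1',v_2'\in V(G)\setminus\{v,v_1,v_2\}$ with $v_1v_1',v_2v_2'\in E(G)$. -}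

module Defs where

open import Data.Nat using (ℕ; _≤_; _<_)
open import Data.Fin using (Fin; _≟_; #_)
open import Data.Bool using (Bool; true; false; _∨_; _∧_)
open import Data.List using (length; filterᵇ; allFin)
open import Data.Product using (Σ; _×_; _,_; ∃)
open import Data.Sum using (_⊎_)
open import Relation.Nullary using (¬_)
open import Relation.Nullary.Decidable using (⌊_⌋)
open import Relation.Binary.PropositionalEquality using (_≡_; _≢_)
open import Function.Definitions using (Injective)

record Graph (n : ℕ) : Set where
  field
    adj     : Fin n → Fin n → Bool
    symm    : ∀ u w → adj u w ≡ adj w u
    irrefl  : ∀ u → adj u u ≡ false
open Graph public

module _ {n : ℕ} (G : Graph n) where

  deg : Fin n → ℕ
  deg v = length (filterᵇ (adj G v) (allFin n))

  MinDegreeIs : ℕ → Set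
  MinDegreeIs k = (Σ (Fin n) λ w → deg w ≡ k) × (∀ w → k ≤ deg w)

  NbhdIs : Fin n → Fin n → Fin n → Set
  NbhdIs v a b = ∀ w → (adj G v w ≡ true → (w ≡ a ⊎ w ≡ b))
                     × ((w ≡ a ⊎ w ≡ b) → adj G v w ≡ true)

  data Reach : Fin n → Fin n → Set where
    here : ∀ {u} → Reach u u
    step : ∀ {u x w} → adj G u x ≡ true → Reach x w → Reach u w

  Connected : Set
  Connected = ∀ u w → Reach u w

addEdgeAdj : {n : ℕ} → Graph n → Fin n → Fin n → (Fin n → Fin n → Bool)
addEdgeAdj G u v x y =
  adj G x y ∨ ((⌊ x ≟ u ⌋ ∧ ⌊ y ≟ v ⌋) ∨ (⌊ x ≟ v ⌋ ∧ ⌊ y ≟ u ⌋))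

-- The virus K^3_3 on Fin 6: triangle 0,1,2 with pendants 3–0, 4–1, 5–2.
data K33Edge : Fin 6 → Fin 6 → Set where
  e01 : K33Edge (# 0) (# 1)
  e12 : K33Edge (# 1) (# 2)
  e02 : K33Edge (# 0) (# 2)
  e03 : K33Edge (# 0) (# 3)
  e14 : K33Edge (# 1) (# 4)
  e25 : K33Edge (# 2) (# 5)

ContainsK33 : {n : ℕ} → (Fin n → Fin n → Bool) → Set
ContainsK33 {n} A = Σ (Fin 6 → Fin n) λ f →
  Injective _≡_ _≡_ f × (∀ i j → K33Edge i j → A (f i) (f j) ≡ true)

-- K^3_3-saturated (graphs with fewer than 6 vertices are not saturated)
K33Saturated : {n : ℕ} → Graph n → Set
K33Saturated {n} G =
  6 ≤ n
  × ¬ ContainsK33 (adj G)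
  × (∀ u v → u ≢ v → adj G u v ≡ false → ContainsK33 (addEdgeAdj G u v))

module _ {n : ℕ} (G : Graph n) where

  TypeI : Fin n → Set
  TypeI v = deg G v ≡ 2 × Σ (Fin n) λ v₁ → Σ (Fin n) λ v₂ → NbhdIs G v v₁ v₂
    × deg G v₁ ≡ 2
    × (Σ (Fin n) λ v₃ → adj G v₁ v₃ ≡ true × v₃ ≢ v × adj G v₃ v₂ ≡ true
         × 3 ≤ deg G v₂ × 3 ≤ deg G v₃)

  TypeII : Fin n → Set
  TypeII v = deg G v ≡ 2 × Σ (Fin n) λ v₁ → Σ (Fin n) λ v₂ → NbhdIs G v v₁ v₂
    × deg G v₁ ≡ 2 × NbhdIs G v₁ v v₂ × 3 ≤ deg G v₂

  TypeIII : Fin n → Set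
  TypeIII v = deg G v ≡ 2 × Σ (Fin n) λ v₁ → Σ (Fin n) λ v₂ → NbhdIs G v v₁ v₂
    × 3 ≤ deg G v₁ × 3 ≤ deg G v₂ × adj G v₁ v₂ ≡ false

  TypeIV : Fin n → Set
  TypeIV v = deg G v ≡ 2 × Σ (Fin n) λ v₁ → Σ (Fin n) λ v₂ → NbhdIs G v v₁ v₂
    × 3 ≤ deg G v₁ × 3 ≤ deg G v₂ × adj G v₁ v₂ ≡ true
    × (Σ (Fin n) λ v₁' → Σ (Fin n) λ v₂' → v₁' ≢ v₂'
         × v₁' ≢ v × v₁' ≢ v₁ × v₁' ≢ v₂
         × v₂' ≢ v × v₂' ≢ v₁ × v₂' ≢ v₂
         × adj G v₁ v₁' ≡ true × adj G v₂ v₂' ≡ true)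

-- Let N(v) = {a, b}.  If a has degree 2, let c be its other neighbour.  If c = b, then v is
-- of type II, unless b has degree 2 as well; but then the triangle vab is a whole component
-- of the connected graph G on at least 6 vertices.  If c ≠ b, then v is of type I unless
-- c ≁ b or one of b, c has degree 2.  If a and b both have degree at least 3, then v is of
-- type III when a ≁ b, and of type IV when a and b have distinct neighbours outside
-- {v, a, b}, which can only fail if N(a) = {v, b, x} and N(b) = {v, a, x}.
--
-- In each of the three leftover configurations, adding the non-edge ab, vc or vx
-- respectively creates no copy of K³₃ that was not already in G, contradicting saturation.
-- A new copy has to use the new edge uw, as a triangle edge or as a pendant edge.  Most
-- placements are excluded by counting neighbours in the small neighbourhoods around v; in
-- the remaining one w lies on the triangle with pendant u, and u can be replaced by an old
-- neighbour of w outside the copy, giving a copy in G.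
module Submission where

open import Defs
open import Data.Bool using (true; false; _∨_; _∧_; T; T?)
open import Data.Bool.Properties using (T-≡; T-∨; ∨-comm; ∧-comm; ¬-not; not-¬)
open import Data.Empty using (⊥; ⊥-elim)
open import Data.Fin using (Fin; zero; suc; #_; _≟_)
open import Data.Fin.Permutation using (Permutation′; transpose; _∘ₚ_; _⟨$⟩ʳ_; _⟨$⟩ˡ_; inverseˡ)
open import Data.List using (List; []; _∷_; length; filterᵇ; allFin)
open import Data.List.Properties using (length-removeAt′; length-tabulate)
open import Data.List.Membership.Propositional using (_∈_; _∉_; _─_)
open import Data.List.Membership.Propositional.Properties using (∈-filter⁺; ∈-filter⁻; ∈-allFin; ∈-++⁺ˡ)
import Data.List.Membership.DecPropositional as DecMembership
open import Data.List.Relation.Binary.Subset.Propositional using (_⊆_)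
open import Data.List.Relation.Unary.All as All using ([]; _∷_)
open import Data.List.Relation.Unary.AllPairs using ([]; _∷_)
open import Data.List.Relation.Unary.Any using (here; there; index)
open import Data.List.Relation.Unary.Unique.Propositional using (Unique)
open import Data.List.Relation.Unary.Unique.Propositional.Properties using (allFin⁺; filter⁺)
open import Data.Nat using (ℕ; suc; _≤_; _<_; z≤n; s≤s)
open import Data.Nat.Properties using (≤-reflexive; ≤-trans; <-irrefl; m≤n⇒m<n∨m≡n; module ≤-Reasoning)
open import Data.Product as Product using (∃; ∃₂; _×_; _,_; proj₁; proj₂)
open import Data.Sum as Sum using (_⊎_; inj₁; inj₂; [_,_])
open import Data.Vec using (Vec; []; _∷_; lookup; _[_]≔_)
open import Data.Vec.Properties using (lookup∘tabulate; lookup∘update; lookup∘update′)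
open import Function using (id; _∘_; Equivalence)
open import Function.Definitions using (Injective)
open import Level using (Level)
open import Relation.Binary.Definitions using (DecidableEquality)
open import Relation.Binary.PropositionalEquality using (_≡_; _≢_; refl; sym; trans; cong; cong₂; subst₂)
open import Relation.Nullary using (¬_; yes; no; contradiction)
open import Relation.Nullary.Decidable using (⌊_⌋; False; toWitnessFalse)

private variable
  ℓ : Level
  A : Set ℓ
  m n : ℕ

∈-─⁺ : ∀ {x y : A} {ys} (x∈ys : x ∈ ys) → y ∈ ys → y ≢ x → y ∈ ys ─ x∈ys
∈-─⁺ (here refl)  (here refl)  y≢x = contradiction refl y≢x
∈-─⁺ (here refl)  (there y∈ys) _   = y∈ys
∈-─⁺ (there _)    (here refl)  _   = here refl
∈-─⁺ (there x∈ys) (there y∈ys) y≢x = there (∈-─⁺ x∈ys y∈ys y≢x)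

Unique-⊆⇒length≤ : ∀ {xs ys : List A} → Unique xs → xs ⊆ ys → length xs ≤ length ys
Unique-⊆⇒length≤ [] _ = z≤n
Unique-⊆⇒length≤ {xs = x ∷ xs} {ys} (x≢xs ∷ xs!) x∷xs⊆ys = begin
  suc (length xs)          ≤⟨ s≤s (Unique-⊆⇒length≤ xs! xs⊆ys─x) ⟩
  suc (length (ys ─ x∈ys)) ≡⟨ sym (length-removeAt′ ys (index x∈ys)) ⟩
  length ys                ∎
  where
  open ≤-Reasoning
  x∈ys = x∷xs⊆ys (here refl)
  xs⊆ys─x : xs ⊆ ys ─ x∈ys
  xs⊆ys─x y∈xs = ∈-─⁺ x∈ys (x∷xs⊆ys (there y∈xs)) (λ y≡x → All.lookup x≢xs y∈xs (sym y≡x))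

module _ (_≟ᴬ_ : DecidableEquality A) where
  open DecMembership _≟ᴬ_ using (_∈?_)

  ∉-or-⊆ : ∀ (ys xs : List A) → (∃ λ y → y ∈ ys × y ∉ xs) ⊎ ys ⊆ xs
  ∉-or-⊆ []       xs = inj₂ λ ()
  ∉-or-⊆ (y ∷ ys) xs with y ∈? xs | ∉-or-⊆ ys xs
  ... | no y∉xs  | _                      = inj₁ (y , here refl , y∉xs)
  ... | yes _    | inj₁ (z , z∈ys , z∉xs) = inj₁ (z , there z∈ys , z∉xs)
  ... | yes y∈xs | inj₂ ys⊆xs             = inj₂ λ { (here refl) → y∈xs ; (there z∈ys) → ys⊆xs z∈ys }

∉-pair : ∀ {x p q : A} → x ≢ p → x ≢ q → x ∉ p ∷ q ∷ []
∉-pair x≢p x≢q (here x≡p)         = x≢p x≡p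
∉-pair x≢p x≢q (there (here x≡q)) = x≢q x≡q

[]≔-injective : ∀ {xs : Vec A m} {i y} → Injective _≡_ _≡_ (lookup xs) →
                (∀ j → j ≢ i → y ≢ lookup xs j) → Injective _≡_ _≡_ (lookup (xs [ i ]≔ y))
[]≔-injective {xs = xs} {i} {y} inj fresh {j} {k} eq with j ≟ i | k ≟ i
... | yes refl | yes refl = refl
... | yes refl | no k≢i   =
  contradiction (trans (sym (lookup∘update i xs y)) (trans eq (lookup∘update′ k≢i xs y))) (fresh k k≢i)
... | no j≢i   | yes refl =
  contradiction (trans (sym (lookup∘update i xs y)) (trans (sym eq) (lookup∘update′ j≢i xs y))) (fresh j j≢i)
... | no j≢i   | no k≢i   =
  inj (trans (sym (lookup∘update′ j≢i xs y)) (trans eq (lookup∘update′ k≢i xs y)))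

infix 4 _⊢_~_ _⊢N[_]⊆_

_⊢_~_ : Graph n → Fin n → Fin n → Set
G ⊢ x ~ y = adj G x y ≡ true

_⊢N[_]⊆_ : Graph n → Fin n → List (Fin n) → Set
G ⊢N[ x ]⊆ ws = ∀ {y} → G ⊢ x ~ y → y ∈ ws

-- deg G x is definitionally length (nbrs G x).
nbrs : Graph n → Fin n → List (Fin n)
nbrs {n} G x = filterᵇ (adj G x) (allFin n)

module Neighbourhoods (G : Graph n) where

  ~-sym : ∀ {x y} → G ⊢ x ~ y → G ⊢ y ~ x
  ~-sym {x} {y} x~y = trans (symm G y x) x~y

  ~-irrefl : ∀ {x y} → G ⊢ x ~ y → x ≢ y
  ~-irrefl {x} x~x refl with () ← trans (sym (irrefl G x)) x~x

  ⊢N⊆⇒≁ : ∀ {x y ws} → G ⊢N[ x ]⊆ ws → y ∉ ws → adj G x y ≡ false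
  ⊢N⊆⇒≁ N y∉ws = ¬-not (y∉ws ∘ N)

  nbhdIs : ∀ {x p q} → G ⊢N[ x ]⊆ p ∷ q ∷ [] → G ⊢ x ~ p → G ⊢ x ~ q → NbhdIs G x p q
  nbhdIs {x} {p} {q} N x~p x~q y = from-pair ∘ N , [ (λ { refl → x~p }) , (λ { refl → x~q }) ]
    where
    from-pair : y ∈ p ∷ q ∷ [] → y ≡ p ⊎ y ≡ q
    from-pair (here y≡p)         = inj₁ y≡p
    from-pair (there (here y≡q)) = inj₂ y≡q

  ∈-nbrs⁺ : ∀ {x y} → G ⊢ x ~ y → y ∈ nbrs G x
  ∈-nbrs⁺ {x} {y} x~y = ∈-filter⁺ (T? ∘ adj G x) (∈-allFin y) (Equivalence.from T-≡ x~y)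

  ∈-nbrs⁻ : ∀ {x y} → y ∈ nbrs G x → G ⊢ x ~ y
  ∈-nbrs⁻ {x} y∈ = Equivalence.to T-≡ (proj₂ (∈-filter⁻ (T? ∘ adj G x) {xs = allFin n} y∈))

  deg≤length : ∀ {x ws} → G ⊢N[ x ]⊆ ws → deg G x ≤ length ws
  deg≤length {x} N = Unique-⊆⇒length≤ (filter⁺ (T? ∘ adj G x) (allFin⁺ n)) (N ∘ ∈-nbrs⁻)

  length≤deg : ∀ {x ws} → Unique ws → (∀ {y} → y ∈ ws → G ⊢ x ~ y) → length ws ≤ deg G x
  length≤deg ws! ws⊆N = Unique-⊆⇒length≤ ws! (∈-nbrs⁺ ∘ ws⊆N)

  nbr-∉-or-⊢N⊆ : ∀ x ws → (∃ λ y → G ⊢ x ~ y × y ∉ ws) ⊎ G ⊢N[ x ]⊆ ws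
  nbr-∉-or-⊢N⊆ x ws with ∉-or-⊆ _≟_ (nbrs G x) ws
  ... | inj₁ (y , y∈N , y∉ws) = inj₁ (y , ∈-nbrs⁻ y∈N , y∉ws)
  ... | inj₂ N⊆ws             = inj₂ (N⊆ws ∘ ∈-nbrs⁺)

  nbr-∉ : ∀ {x ws} → length ws < deg G x → ∃ λ y → G ⊢ x ~ y × y ∉ ws
  nbr-∉ {x} {ws} ws<deg with nbr-∉-or-⊢N⊆ x ws
  ... | inj₁ y = y
  ... | inj₂ N = contradiction (≤-trans ws<deg (deg≤length N)) (<-irrefl refl)

  two-distinct-nbrs : ∀ {x} → 2 ≤ deg G x → ∃₂ λ a b → G ⊢ x ~ a × G ⊢ x ~ b × a ≢ b
  two-distinct-nbrs 2≤deg with a , x~a , _   ← nbr-∉ {ws = []} (≤-trans (s≤s z≤n) 2≤deg)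
                          with b , x~b , b∉a ← nbr-∉ {ws = a ∷ []} 2≤deg
    = a , b , x~a , x~b , b∉a ∘ here ∘ sym

  deg≡2⇒⊢N⊆ : ∀ {x p q} → deg G x ≡ 2 → G ⊢ x ~ p → G ⊢ x ~ q → p ≢ q →
              G ⊢N[ x ]⊆ p ∷ q ∷ []
  deg≡2⇒⊢N⊆ {x} {p} {q} deg≡2 x~p x~q p≢q with nbr-∉-or-⊢N⊆ x (p ∷ q ∷ [])
  ... | inj₂ N                = N
  ... | inj₁ (y , x~y , y∉pq) = contradiction (≤-trans 3≤deg (≤-reflexive deg≡2)) λ { (s≤s (s≤s ())) }
    where
    3≤deg : 3 ≤ deg G x
    3≤deg = length≤deg
      ((p≢q ∷ (y∉pq ∘ here ∘ sym) ∷ []) ∷ ((y∉pq ∘ there ∘ here ∘ sym) ∷ []) ∷ [] ∷ [])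
      λ { (here refl) → x~p ; (there (here refl)) → x~q ; (there (there (here refl))) → x~y }

  Closed : List (Fin n) → Set
  Closed ws = ∀ {x y} → G ⊢ x ~ y → x ∈ ws → y ∈ ws

  Reach-closed : ∀ {ws x y} → Closed ws → Reach G x y → x ∈ ws → y ∈ ws
  Reach-closed closed here         x∈ws = x∈ws
  Reach-closed closed (step x~z r) x∈ws = Reach-closed closed r (closed x~z x∈ws)

  connected-closed⇒n≤length : ∀ {ws x} → Connected G → Closed ws → x ∈ ws → n ≤ length ws
  connected-closed⇒n≤length {ws} {x} conn closed x∈ws = begin
    n                 ≡⟨ sym (length-tabulate id) ⟩
    length (allFin n) ≤⟨ Unique-⊆⇒length≤ (allFin⁺ n) (λ {y} _ → Reach-closed closed (conn x y) x∈ws) ⟩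
    length ws         ∎
    where open ≤-Reasoning

  connected-triangle⇒n≤3 : ∀ {v a b} → Connected G →
    G ⊢N[ v ]⊆ a ∷ b ∷ [] → G ⊢N[ a ]⊆ v ∷ b ∷ [] → G ⊢N[ b ]⊆ v ∷ a ∷ [] → n ≤ 3
  connected-triangle⇒n≤3 {v} {a} {b} conn Nv Na Nb = connected-closed⇒n≤length conn closed (here refl)
    where
    closed : Closed (v ∷ a ∷ b ∷ [])
    closed x~y (here refl)                 = there (Nv x~y)
    closed x~y (there (here refl))         with Na x~y
    ... | here y≡v  = here y≡v
    ... | there y∈b = there (there y∈b)
    closed x~y (there (there (here refl))) = ∈-++⁺ˡ (Nb x~y)

_+edge_ : (G : Graph n) {u w : Fin n} → u ≢ w → Graph n
_+edge_ G {u} {w} u≢w = record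
  { adj    = addEdgeAdj G u w
  ; symm   = λ x y → cong₂ _∨_ (symm G x y) (new-symm x y)
  ; irrefl = no-loop
  }
  where
  new-symm : ∀ x y → (⌊ x ≟ u ⌋ ∧ ⌊ y ≟ w ⌋) ∨ (⌊ x ≟ w ⌋ ∧ ⌊ y ≟ u ⌋)
                   ≡ (⌊ y ≟ u ⌋ ∧ ⌊ x ≟ w ⌋) ∨ (⌊ y ≟ w ⌋ ∧ ⌊ x ≟ u ⌋)
  new-symm x y = trans (∨-comm (⌊ x ≟ u ⌋ ∧ ⌊ y ≟ w ⌋) _)
                       (cong₂ _∨_ (∧-comm ⌊ x ≟ w ⌋ _) (∧-comm ⌊ x ≟ u ⌋ _))
  no-loop : ∀ x → addEdgeAdj G u w x x ≡ false
  no-loop x rewrite irrefl G x with x ≟ u | x ≟ w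
  ... | yes refl | yes refl = contradiction refl u≢w
  ... | yes _    | no _     = refl
  ... | no _     | yes _    = refl
  ... | no _     | no _     = refl

SameEdge : Fin n → Fin n → Fin n → Fin n → Set
SameEdge x y u w = (x ≡ u × y ≡ w) ⊎ (x ≡ w × y ≡ u)

SameEdge-flip : ∀ {x y u w : Fin n} → SameEdge x y u w → SameEdge y x u w
SameEdge-flip = [ inj₂ ∘ Product.swap , inj₁ ∘ Product.swap ]

T-≟∧≟ : ∀ {x u y w : Fin n} → T (⌊ x ≟ u ⌋ ∧ ⌊ y ≟ w ⌋) → x ≡ u × y ≡ w
T-≟∧≟ {x = x} {u} {y} {w} with x ≟ u | y ≟ w
... | yes x≡u | yes y≡w = λ _ → x≡u , y≡w
... | yes _   | no _    = λ ()
... | no _    | _       = λ ()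

K33Copy : Graph n → (Fin 6 → Fin n) → Set
K33Copy K f = Injective _≡_ _≡_ f × (∀ i j → K33Edge i j → K ⊢ f i ~ f j)

K33Edge-all-or-some : {P Q : Fin 6 → Fin 6 → Set} → (∀ {i j} → K33Edge i j → P i j ⊎ Q i j) →
                      (∀ i j → K33Edge i j → P i j) ⊎ ∃₂ λ i j → K33Edge i j × Q i j
K33Edge-all-or-some dec with dec e01 | dec e12 | dec e02 | dec e03 | dec e14 | dec e25
... | inj₁ p01 | inj₁ p12 | inj₁ p02 | inj₁ p03 | inj₁ p14 | inj₁ p25 =
  inj₁ λ { _ _ e01 → p01 ; _ _ e12 → p12 ; _ _ e02 → p02 ; _ _ e03 → p03 ; _ _ e14 → p14 ; _ _ e25 → p25 }
... | inj₂ q | _      | _      | _      | _      | _      = inj₂ (_ , _ , e01 , q)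
... | _      | inj₂ q | _      | _      | _      | _      = inj₂ (_ , _ , e12 , q)
... | _      | _      | inj₂ q | _      | _      | _      = inj₂ (_ , _ , e02 , q)
... | _      | _      | _      | inj₂ q | _      | _      = inj₂ (_ , _ , e03 , q)
... | _      | _      | _      | _      | inj₂ q | _      = inj₂ (_ , _ , e14 , q)
... | _      | _      | _      | _      | _      | inj₂ q = inj₂ (_ , _ , e25 , q)

-- t₀ t₁ t₂ is the triangle and pᵢ the pendant vertex at tᵢ.
record Virus (K : Graph n) (t₀ t₁ t₂ p₀ p₁ p₂ : Fin n) : Set where
  vertex : Fin 6 → Fin n
  vertex = lookup (t₀ ∷ t₁ ∷ t₂ ∷ p₀ ∷ p₁ ∷ p₂ ∷ [])

  field
    injective : Injective _≡_ _≡_ vertex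
    edge      : ∀ i j → K33Edge i j → K ⊢ vertex i ~ vertex j

  copy : K33Copy K vertex
  copy = injective , edge

  containsK33 : ContainsK33 (adj K)
  containsK33 = vertex , copy

  -- For distinct literals i and j the implicit proofs are found by evaluation.
  apart : (i j : Fin 6) → {False (i ≟ j)} → vertex i ≢ vertex j
  apart i j {i≢j} = toWitnessFalse i≢j ∘ injective

  apart₂ : (i j k : Fin 6) → {False (i ≟ j)} → {False (i ≟ k)} → vertex i ∉ vertex j ∷ vertex k ∷ []
  apart₂ i j k {i≢j} {i≢k} = ∉-pair (apart i j {i≢j}) (apart i k {i≢k})

  apart₃ : (i j k l : Fin 6) → {False (i ≟ j)} → {False (i ≟ k)} → {False (i ≟ l)} →
           vertex i ∉ vertex j ∷ vertex k ∷ vertex l ∷ []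
  apart₃ i j k l {i≢j} {_}   {_}   (here eq)   = apart i j {i≢j} eq
  apart₃ i j k l {_}   {i≢k} {i≢l} (there k∨l) = apart₂ i k l {i≢k} {i≢l} k∨l

open Virus using (edge; copy; containsK33; apart; apart₂; apart₃)

private variable
  K : Graph n
  f : Fin 6 → Fin n
  t₀ t₁ t₂ p₀ p₁ p₂ u w x y z : Fin n

K33Copy⇒Virus : K33Copy K f → Virus K (f (# 0)) (f (# 1)) (f (# 2)) (f (# 3)) (f (# 4)) (f (# 5))
K33Copy⇒Virus {K = K} {f = f} (inj , edge) = record
  { injective = λ {i} {j} eq → inj (trans (sym (lookup∘tabulate f i)) (trans eq (lookup∘tabulate f j)))
  ; edge      = λ i j e → subst₂ (K ⊢_~_) (sym (lookup∘tabulate f i)) (sym (lookup∘tabulate f j)) (edge i j e)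
  }

K33Automorphism : Permutation′ 6 → Set
K33Automorphism π =
  ∀ {i j} → K33Edge i j → K33Edge (π ⟨$⟩ʳ i) (π ⟨$⟩ʳ j) ⊎ K33Edge (π ⟨$⟩ʳ j) (π ⟨$⟩ʳ i)

K33Copy-∘ : (π : Permutation′ 6) → K33Automorphism π → K33Copy K f → K33Copy K (f ∘ (π ⟨$⟩ʳ_))
K33Copy-∘ {K = K} π aut (inj , edge) =
  (λ eq → trans (sym (inverseˡ π)) (trans (cong (π ⟨$⟩ˡ_) (inj eq)) (inverseˡ π))) ,
  (λ i j e → [ edge _ _ , Neighbourhoods.~-sym K ∘ edge _ _ ] (aut e))

swap₀₁ : Virus K t₀ t₁ t₂ p₀ p₁ p₂ → Virus K t₁ t₀ t₂ p₁ p₀ p₂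
swap₀₁ {K = K} V = K33Copy⇒Virus (K33Copy-∘ {K = K} σ aut (copy V))
  where
  σ = transpose (# 0) (# 1) ∘ₚ transpose (# 3) (# 4)
  aut : K33Automorphism σ
  aut e01 = inj₂ e01
  aut e12 = inj₁ e02
  aut e02 = inj₁ e12
  aut e03 = inj₁ e14
  aut e14 = inj₁ e03
  aut e25 = inj₁ e25

swap₁₂ : Virus K t₀ t₁ t₂ p₀ p₁ p₂ → Virus K t₀ t₂ t₁ p₀ p₂ p₁
swap₁₂ {K = K} V = K33Copy⇒Virus (K33Copy-∘ {K = K} σ aut (copy V))
  where
  σ = transpose (# 1) (# 2) ∘ₚ transpose (# 4) (# 5)
  aut : K33Automorphism σ
  aut e01 = inj₁ e02
  aut e12 = inj₂ e12
  aut e02 = inj₁ e01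
  aut e03 = inj₁ e03
  aut e14 = inj₁ e25
  aut e25 = inj₁ e14

swap₀₂ : Virus K t₀ t₁ t₂ p₀ p₁ p₂ → Virus K t₂ t₁ t₀ p₂ p₁ p₀
swap₀₂ {K = K} V = K33Copy⇒Virus (K33Copy-∘ {K = K} σ aut (copy V))
  where
  σ = transpose (# 0) (# 2) ∘ₚ transpose (# 3) (# 5)
  aut : K33Automorphism σ
  aut e01 = inj₂ e12
  aut e12 = inj₂ e01
  aut e02 = inj₂ e02
  aut e03 = inj₁ e25
  aut e14 = inj₁ e14
  aut e25 = inj₁ e03

VirusWithTriangleEdge : Graph n → Fin n → Fin n → Set
VirusWithTriangleEdge K x y = ∃ λ t₂ → ∃ λ p₀ → ∃ λ p₁ → ∃ λ p₂ → Virus K x y t₂ p₀ p₁ p₂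

VirusWithPendantEdge : Graph n → Fin n → Fin n → Set
VirusWithPendantEdge K x y = ∃ λ t₁ → ∃ λ t₂ → ∃ λ p₁ → ∃ λ p₂ → Virus K x t₁ t₂ y p₁ p₂

triangle-edge : SameEdge t₀ t₁ u w → Virus K t₀ t₁ t₂ p₀ p₁ p₂ → VirusWithTriangleEdge K u w
triangle-edge (inj₁ (refl , refl)) V = _ , _ , _ , _ , V
triangle-edge (inj₂ (refl , refl)) V = _ , _ , _ , _ , swap₀₁ V

pendant-edge : SameEdge t₀ p₀ u w → Virus K t₀ t₁ t₂ p₀ p₁ p₂ →
               VirusWithPendantEdge K u w ⊎ VirusWithPendantEdge K w u
pendant-edge (inj₁ (refl , refl)) V = inj₁ (_ , _ , _ , _ , V)
pendant-edge (inj₂ (refl , refl)) V = inj₂ (_ , _ , _ , _ , V)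

triangle-vertex-¬⊢N⊆pair : Virus K t₀ t₁ t₂ p₀ p₁ p₂ → ¬ K ⊢N[ t₀ ]⊆ x ∷ y ∷ []
triangle-vertex-¬⊢N⊆pair {t₁ = t₁} {t₂} {p₀} {x = x} {y} V N =
  contradiction (Unique-⊆⇒length≤ distinct nbrs⊆xy) λ { (s≤s (s≤s ())) }
  where
  distinct : Unique (t₁ ∷ t₂ ∷ p₀ ∷ [])
  distinct = (apart V (# 1) (# 2) ∷ apart V (# 1) (# 3) ∷ []) ∷ (apart V (# 2) (# 3) ∷ []) ∷ [] ∷ []
  nbrs⊆xy : t₁ ∷ t₂ ∷ p₀ ∷ [] ⊆ x ∷ y ∷ []
  nbrs⊆xy (here refl)                 = N (edge V _ _ e01)
  nbrs⊆xy (there (here refl))         = N (edge V _ _ e02)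
  nbrs⊆xy (there (there (here refl))) = N (edge V _ _ e03)

⊢N⊆pair⇒avoids : K ⊢N[ z ]⊆ y ∷ x ∷ [] → Virus K x t₁ t₂ y p₁ p₂ → z ≢ t₁ × z ≢ p₁
⊢N⊆pair⇒avoids {K = K} {z = z} {t₁ = t₁} {p₁ = p₁} N V = z≢t₁ , z≢p₁
  where
  z≢t₁ : z ≢ t₁
  z≢t₁ refl = triangle-vertex-¬⊢N⊆pair (swap₀₁ V) N
  z≢p₁ : z ≢ p₁
  z≢p₁ refl = apart₂ V (# 1) (# 3) (# 0) (N (Neighbourhoods.~-sym K (edge V _ _ e14)))

module AddEdge (G : Graph n) {u w : Fin n} (u≢w : u ≢ w) where

  open Neighbourhoods G

  +edge-~ : (G +edge u≢w) ⊢ x ~ y → G ⊢ x ~ y ⊎ SameEdge x y u w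
  +edge-~ x~y with Equivalence.to T-∨ (Equivalence.from T-≡ x~y)
  ... | inj₁ old = inj₁ (Equivalence.to T-≡ old)
  ... | inj₂ new = inj₂ (Sum.map T-≟∧≟ T-≟∧≟ (Equivalence.to T-∨ new))

  +edge-~⁻ : x ≢ u → y ≢ u → (G +edge u≢w) ⊢ x ~ y → G ⊢ x ~ y
  +edge-~⁻ x≢u y≢u x~y with +edge-~ x~y
  ... | inj₁ old              = old
  ... | inj₂ (inj₁ (x≡u , _)) = contradiction x≡u x≢u
  ... | inj₂ (inj₂ (_ , y≡u)) = contradiction y≡u y≢u

  ⊢N⊆-+edge : ∀ {ws} → x ≢ u → x ≢ w → G ⊢N[ x ]⊆ ws → (G +edge u≢w) ⊢N[ x ]⊆ ws
  ⊢N⊆-+edge x≢u x≢w N x~y with +edge-~ x~y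
  ... | inj₁ old              = N old
  ... | inj₂ (inj₁ (x≡u , _)) = contradiction x≡u x≢u
  ... | inj₂ (inj₂ (x≡w , _)) = contradiction x≡w x≢w

  ⊢N⊆-+edgeˡ : ∀ {ws} → G ⊢N[ u ]⊆ ws → (G +edge u≢w) ⊢N[ u ]⊆ w ∷ ws
  ⊢N⊆-+edgeˡ N u~y with +edge-~ u~y
  ... | inj₁ old              = there (N old)
  ... | inj₂ (inj₁ (_ , y≡w)) = here y≡w
  ... | inj₂ (inj₂ (u≡w , _)) = contradiction u≡w u≢w

  ⊢N⊆-+edgeʳ : ∀ {ws} → G ⊢N[ w ]⊆ ws → (G +edge u≢w) ⊢N[ w ]⊆ u ∷ ws
  ⊢N⊆-+edgeʳ N w~y with +edge-~ w~y
  ... | inj₁ old              = there (N old)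
  ... | inj₂ (inj₁ (w≡u , _)) = contradiction (sym w≡u) u≢w
  ... | inj₂ (inj₂ (_ , y≡u)) = here y≡u

  new-virus : ContainsK33 (adj (G +edge u≢w)) →
              ContainsK33 (adj G) ⊎ VirusWithTriangleEdge (G +edge u≢w) u w
              ⊎ VirusWithPendantEdge (G +edge u≢w) u w ⊎ VirusWithPendantEdge (G +edge u≢w) w u
  new-virus (f , inj , edge)
    with K33Copy⇒Virus {K = G +edge u≢w} (inj , edge) | K33Edge-all-or-some (+edge-~ ∘ edge _ _)
  ... | _ | inj₁ old               = inj₁ (f , inj , old)
  ... | V | inj₂ (_ , _ , e01 , s) = inj₂ (inj₁ (triangle-edge s V))
  ... | V | inj₂ (_ , _ , e12 , s) = inj₂ (inj₁ (triangle-edge (SameEdge-flip s) (swap₀₂ V)))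
  ... | V | inj₂ (_ , _ , e02 , s) = inj₂ (inj₁ (triangle-edge s (swap₁₂ V)))
  ... | V | inj₂ (_ , _ , e03 , s) = inj₂ (inj₂ (pendant-edge s V))
  ... | V | inj₂ (_ , _ , e14 , s) = inj₂ (inj₂ (pendant-edge s (swap₀₁ V)))
  ... | V | inj₂ (_ , _ , e25 , s) = inj₂ (inj₂ (pendant-edge s (swap₀₂ V)))

  -- The condition on z is stated for every such copy so that, through swap₁₂, it also
  -- covers the second branch t₂ p₂.
  pendant-swap :
    (∀ {t₁ t₂ p₁ p₂} → Virus (G +edge u≢w) w t₁ t₂ u p₁ p₂ → z ≢ t₁ × z ≢ p₁) →
    G ⊢ w ~ z → VirusWithPendantEdge (G +edge u≢w) w u → ContainsK33 (adj G)
  pendant-swap {z = z} avoids w~z (t₁ , t₂ , p₁ , p₂ , V) = containsK33 swapped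
    where
    fresh : ∀ j → j ≢ # 3 → z ≢ lookup (w ∷ t₁ ∷ t₂ ∷ u ∷ p₁ ∷ p₂ ∷ []) j
    fresh zero                                _   = ~-irrefl (~-sym w~z)
    fresh (suc zero)                          _   = proj₁ (avoids V)
    fresh (suc (suc zero))                    _   = proj₁ (avoids (swap₁₂ V))
    fresh (suc (suc (suc zero)))              j≢3 = contradiction refl j≢3
    fresh (suc (suc (suc (suc zero))))        _   = proj₂ (avoids V)
    fresh (suc (suc (suc (suc (suc zero))))) _   = proj₂ (avoids (swap₁₂ V))
    swapped : Virus G w t₁ t₂ z p₁ p₂
    swapped = record
      { injective = []≔-injective {xs = w ∷ t₁ ∷ t₂ ∷ u ∷ p₁ ∷ p₂ ∷ []} (Virus.injective V) fresh
      ; edge      = λ where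
          _ _ e01 → +edge-~⁻ (apart V (# 0) (# 3)) (apart V (# 1) (# 3)) (edge V _ _ e01)
          _ _ e12 → +edge-~⁻ (apart V (# 1) (# 3)) (apart V (# 2) (# 3)) (edge V _ _ e12)
          _ _ e02 → +edge-~⁻ (apart V (# 0) (# 3)) (apart V (# 2) (# 3)) (edge V _ _ e02)
          _ _ e03 → w~z
          _ _ e14 → +edge-~⁻ (apart V (# 1) (# 3)) (apart V (# 4) (# 3)) (edge V _ _ e14)
          _ _ e25 → +edge-~⁻ (apart V (# 2) (# 3)) (apart V (# 5) (# 3)) (edge V _ _ e25)
      }

  no-new-virus : ¬ VirusWithTriangleEdge (G +edge u≢w) u w → ¬ VirusWithPendantEdge (G +edge u≢w) u w →
                 (VirusWithPendantEdge (G +edge u≢w) w u → ContainsK33 (adj G)) →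
                 ContainsK33 (adj (G +edge u≢w)) → ContainsK33 (adj G)
  no-new-virus ¬triangle ¬pendant swap K33 with new-virus K33
  ... | inj₁ old                = old
  ... | inj₂ (inj₁ tri)         = contradiction tri ¬triangle
  ... | inj₂ (inj₂ (inj₁ pend)) = contradiction pend ¬pendant
  ... | inj₂ (inj₂ (inj₂ pend)) = swap pend

path-chord-no-new-virus : ∀ (G : Graph n) {v a b c} →
  G ⊢N[ v ]⊆ a ∷ b ∷ [] → G ⊢ v ~ a → G ⊢ v ~ b → G ⊢N[ a ]⊆ v ∷ c ∷ [] → G ⊢ a ~ c →
  ¬ G ⊢ c ~ b → (a≢b : a ≢ b) → ContainsK33 (adj (G +edge a≢b)) → ContainsK33 (adj G)
path-chord-no-new-virus G {v} {a} {b} {c} Nv v~a v~b Na a~c c≁b a≢b =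
  no-new-virus ¬triangle ¬pendant (pendant-swap (⊢N⊆pair⇒avoids Nv⁺) (~-sym v~b))
  where
  open Neighbourhoods G
  open AddEdge G a≢b
  Nv⁺ : (G +edge a≢b) ⊢N[ v ]⊆ a ∷ b ∷ []
  Nv⁺ = ⊢N⊆-+edge (~-irrefl v~a) (~-irrefl v~b) Nv
  Na⁺ : (G +edge a≢b) ⊢N[ a ]⊆ b ∷ v ∷ c ∷ []
  Na⁺ = ⊢N⊆-+edgeˡ Na
  ¬triangle : ¬ VirusWithTriangleEdge (G +edge a≢b) a b
  ¬triangle (_ , _ , _ , _ , V) with Na⁺ (edge V _ _ e02)
  ... | here refl                 = apart V (# 2) (# 1) refl
  ... | there (here refl)         = triangle-vertex-¬⊢N⊆pair (swap₀₂ V) Nv⁺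
  ... | there (there (here refl)) = c≁b (~-sym (+edge-~⁻ (a≢b ∘ sym) (~-irrefl a~c ∘ sym) (edge V _ _ e12)))
  ¬pendant : ¬ VirusWithPendantEdge (G +edge a≢b) a b
  ¬pendant (_ , _ , _ , _ , V) with Na⁺ (edge V _ _ e01) | Na⁺ (edge V _ _ e02)
  ... | here refl                 | _                         = apart V (# 1) (# 3) refl
  ... | there (here refl)         | _                         = triangle-vertex-¬⊢N⊆pair (swap₀₁ V) Nv⁺
  ... | _                         | here refl                 = apart V (# 2) (# 3) refl
  ... | _                         | there (here refl)         = triangle-vertex-¬⊢N⊆pair (swap₀₂ V) Nv⁺
  ... | there (there (here refl)) | there (there (here refl)) = apart V (# 1) (# 2) refl

cycle-diagonal-no-new-virus : ∀ (G : Graph n) {v a b c} →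
  G ⊢N[ v ]⊆ a ∷ b ∷ [] → G ⊢ v ~ a → G ⊢ v ~ b → G ⊢N[ a ]⊆ v ∷ c ∷ [] → G ⊢ a ~ c →
  G ⊢ c ~ b → G ⊢N[ c ]⊆ a ∷ b ∷ [] ⊎ G ⊢N[ b ]⊆ v ∷ c ∷ [] →
  (v≢c : v ≢ c) → ContainsK33 (adj (G +edge v≢c)) → ContainsK33 (adj G)
cycle-diagonal-no-new-virus G {v} {a} {b} {c} Nv v~a v~b Na a~c c~b Nc⊎Nb v≢c =
  no-new-virus ¬triangle ¬pendant (pendant-swap (⊢N⊆pair⇒avoids Na⁺) (~-sym a~c))
  where
  open Neighbourhoods G
  open AddEdge G v≢c
  Nv⁺ : (G +edge v≢c) ⊢N[ v ]⊆ c ∷ a ∷ b ∷ []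
  Nv⁺ = ⊢N⊆-+edgeˡ Nv
  Na⁺ : (G +edge v≢c) ⊢N[ a ]⊆ v ∷ c ∷ []
  Na⁺ = ⊢N⊆-+edge (~-irrefl v~a ∘ sym) (~-irrefl a~c) Na
  ¬triangle-vcb : ∀ {p₀ p₁ p₂} → G ⊢N[ c ]⊆ a ∷ b ∷ [] ⊎ G ⊢N[ b ]⊆ v ∷ c ∷ [] →
                  ¬ Virus (G +edge v≢c) v c b p₀ p₁ p₂
  ¬triangle-vcb (inj₂ Nb) V =
    triangle-vertex-¬⊢N⊆pair (swap₀₂ V) (⊢N⊆-+edge (~-irrefl v~b ∘ sym) (~-irrefl c~b ∘ sym) Nb)
  ¬triangle-vcb (inj₁ Nc) V with Nv⁺ (edge V _ _ e03)
  ... | here refl                 = apart V (# 3) (# 1) refl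
  ... | there (here refl)         = apart₃ V (# 4) (# 0) (# 3) (# 2) (⊢N⊆-+edgeʳ Nc (edge V _ _ e14))
  ... | there (there (here refl)) = apart V (# 3) (# 2) refl
  ¬triangle : ¬ VirusWithTriangleEdge (G +edge v≢c) v c
  ¬triangle (_ , _ , _ , _ , V) with Nv⁺ (edge V _ _ e02)
  ... | here refl                 = apart V (# 2) (# 1) refl
  ... | there (here refl)         = triangle-vertex-¬⊢N⊆pair (swap₀₂ V) Na⁺
  ... | there (there (here refl)) = ¬triangle-vcb Nc⊎Nb V
  ¬pendant : ¬ VirusWithPendantEdge (G +edge v≢c) v c
  ¬pendant (_ , _ , _ , _ , V) with Nv⁺ (edge V _ _ e01) | Nv⁺ (edge V _ _ e02)
  ... | here refl                 | _                         = apart V (# 1) (# 3) refl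
  ... | there (here refl)         | _                         = triangle-vertex-¬⊢N⊆pair (swap₀₁ V) Na⁺
  ... | _                         | here refl                 = apart V (# 2) (# 3) refl
  ... | _                         | there (here refl)         = triangle-vertex-¬⊢N⊆pair (swap₀₂ V) Na⁺
  ... | there (there (here refl)) | there (there (here refl)) = apart V (# 1) (# 2) refl

K₄-completion-no-new-virus : ∀ (G : Graph n) {v a b x} →
  G ⊢N[ v ]⊆ a ∷ b ∷ [] → G ⊢ v ~ a → G ⊢ v ~ b →
  G ⊢N[ a ]⊆ v ∷ b ∷ x ∷ [] → G ⊢N[ b ]⊆ v ∷ a ∷ x ∷ [] → G ⊢ a ~ x → G ⊢ b ~ x →
  (v≢x : v ≢ x) → ContainsK33 (adj (G +edge v≢x)) → ContainsK33 (adj G)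
K₄-completion-no-new-virus G {v} {a} {b} {x} Nv v~a v~b Na Nb a~x b~x v≢x =
  no-new-virus ¬triangle ¬pendant (pendant-swap avoids (~-sym a~x))
  where
  open Neighbourhoods G
  open AddEdge G v≢x
  Nv⁺ : (G +edge v≢x) ⊢N[ v ]⊆ x ∷ a ∷ b ∷ []
  Nv⁺ = ⊢N⊆-+edgeˡ Nv
  Na⁺ : (G +edge v≢x) ⊢N[ a ]⊆ v ∷ b ∷ x ∷ []
  Na⁺ = ⊢N⊆-+edge (~-irrefl v~a ∘ sym) (~-irrefl a~x) Na
  Nb⁺ : (G +edge v≢x) ⊢N[ b ]⊆ v ∷ a ∷ x ∷ []
  Nb⁺ = ⊢N⊆-+edge (~-irrefl v~b ∘ sym) (~-irrefl b~x) Nb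
  ¬triangle : ¬ VirusWithTriangleEdge (G +edge v≢x) v x
  ¬triangle (_ , _ , _ , _ , V) with Nv⁺ (edge V _ _ e02) | Nv⁺ (edge V _ _ e03)
  ... | here refl                 | _                         = apart V (# 2) (# 1) refl
  ... | _                         | here refl                 = apart V (# 3) (# 1) refl
  ... | there (here refl)         | there (here refl)         = apart V (# 3) (# 2) refl
  ... | there (there (here refl)) | there (there (here refl)) = apart V (# 3) (# 2) refl
  ... | there (here refl)         | there (there (here refl)) =
    apart₃ V (# 5) (# 0) (# 3) (# 1) (Na⁺ (edge V _ _ e25))
  ... | there (there (here refl)) | there (here refl)         =
    apart₃ V (# 5) (# 0) (# 3) (# 1) (Nb⁺ (edge V _ _ e25))
  ¬pendant : ¬ VirusWithPendantEdge (G +edge v≢x) v x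
  ¬pendant (_ , _ , _ , _ , V) with Nv⁺ (edge V _ _ e01) | Nv⁺ (edge V _ _ e02)
  ... | here refl                 | _                         = apart V (# 1) (# 3) refl
  ... | _                         | here refl                 = apart V (# 2) (# 3) refl
  ... | there (here refl)         | there (here refl)         = apart V (# 1) (# 2) refl
  ... | there (there (here refl)) | there (there (here refl)) = apart V (# 1) (# 2) refl
  ... | there (here refl)         | there (there (here refl)) =
    apart₃ V (# 4) (# 0) (# 2) (# 3) (Na⁺ (edge V _ _ e14))
  ... | there (there (here refl)) | there (here refl)         =
    apart₃ V (# 4) (# 0) (# 2) (# 3) (Nb⁺ (edge V _ _ e14))
  avoids : ∀ {t₁ t₂ p₁ p₂} → Virus (G +edge v≢x) x t₁ t₂ v p₁ p₂ → a ≢ t₁ × a ≢ p₁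
  avoids {t₁} {p₁ = p₁} V = a≢t₁ , a≢p₁
    where
    a≢t₁ : a ≢ t₁
    a≢t₁ refl with Na⁺ (edge V _ _ e12)
    ... | here refl                 = apart V (# 2) (# 3) refl
    ... | there (here refl)         = apart₃ V (# 4) (# 3) (# 2) (# 0) (Na⁺ (edge V _ _ e14))
    ... | there (there (here refl)) = apart V (# 2) (# 0) refl
    a≢p₁ : a ≢ p₁
    a≢p₁ refl with Na⁺ (Neighbourhoods.~-sym (G +edge v≢x) (edge V _ _ e14))
    ... | here refl                 = apart V (# 1) (# 3) refl
    ... | there (here refl)         = apart₃ V (# 2) (# 3) (# 4) (# 0) (Nb⁺ (edge V _ _ e12))
    ... | there (there (here refl)) = apart V (# 1) (# 0) refl

module Degree2Vertex (G : Graph n) (6≤n : 6 ≤ n) (noK : ¬ ContainsK33 (adj G))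
  (saturated : ∀ u w → u ≢ w → adj G u w ≡ false → ContainsK33 (addEdgeAdj G u w))
  (δ≥2 : ∀ w → 2 ≤ deg G w)
  {v a b : Fin n} (dv : deg G v ≡ 2) (v~a : G ⊢ v ~ a) (v~b : G ⊢ v ~ b) (a≢b : a ≢ b)
  where

  open Neighbourhoods G

  Nv : G ⊢N[ v ]⊆ a ∷ b ∷ []
  Nv = deg≡2⇒⊢N⊆ dv v~a v~b a≢b

  typeII : Connected G → deg G a ≡ 2 → G ⊢ a ~ b → TypeII G v
  typeII conn da a~b with m≤n⇒m<n∨m≡n (δ≥2 b)
  ... | inj₁ 3≤db = dv , a , b , nbhdIs Nv v~a v~b , da , nbhdIs Na (~-sym v~a) a~b , 3≤db
    where Na = deg≡2⇒⊢N⊆ da (~-sym v~a) a~b (~-irrefl v~b)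
  ... | inj₂ 2≡db =
    contradiction (≤-trans 6≤n (connected-triangle⇒n≤3 conn Nv Na Nb)) λ { (s≤s (s≤s (s≤s ()))) }
    where
    Na = deg≡2⇒⊢N⊆ da (~-sym v~a) a~b (~-irrefl v~b)
    Nb = deg≡2⇒⊢N⊆ (sym 2≡db) (~-sym v~b) (~-sym a~b) (~-irrefl v~a)

  typeI : ∀ {c} → deg G a ≡ 2 → G ⊢ a ~ c → c ≢ v → c ≢ b → G ⊢ c ~ b → TypeI G v
  typeI {c} da a~c c≢v c≢b c~b = by-degrees (m≤n⇒m<n∨m≡n (δ≥2 b)) (m≤n⇒m<n∨m≡n (δ≥2 c))
    where
    Na : G ⊢N[ a ]⊆ v ∷ c ∷ []
    Na = deg≡2⇒⊢N⊆ da (~-sym v~a) a~c (c≢v ∘ sym)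
    no-degree-2 : G ⊢N[ c ]⊆ a ∷ b ∷ [] ⊎ G ⊢N[ b ]⊆ v ∷ c ∷ [] → ⊥
    no-degree-2 N = noK (cycle-diagonal-no-new-virus G Nv v~a v~b Na a~c c~b N (c≢v ∘ sym)
      (saturated v c (c≢v ∘ sym) (⊢N⊆⇒≁ Nv (∉-pair (~-irrefl a~c ∘ sym) c≢b))))
    by-degrees : 2 < deg G b ⊎ 2 ≡ deg G b → 2 < deg G c ⊎ 2 ≡ deg G c → TypeI G v
    by-degrees (inj₁ 3≤db) (inj₁ 3≤dc) =
      dv , a , b , nbhdIs Nv v~a v~b , da , c , a~c , c≢v , c~b , 3≤db , 3≤dc
    by-degrees (inj₂ 2≡db) _           =
      ⊥-elim (no-degree-2 (inj₂ (deg≡2⇒⊢N⊆ (sym 2≡db) (~-sym v~b) (~-sym c~b) (c≢v ∘ sym))))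
    by-degrees _           (inj₂ 2≡dc) =
      ⊥-elim (no-degree-2 (inj₁ (deg≡2⇒⊢N⊆ (sym 2≡dc) (~-sym a~c) c~b a≢b)))

  typeI-or-II : Connected G → deg G a ≡ 2 → TypeI G v ⊎ TypeII G v
  typeI-or-II conn da with c , a~c , c∉v ← nbr-∉ {ws = v ∷ []} (≤-reflexive (sym da))
                      with c ≟ b | adj G c b in cb
  ... | yes refl | _     = inj₂ (typeII conn da a~c)
  ... | no c≢b   | true  = inj₁ (typeI da a~c (c∉v ∘ here) c≢b cb)
  ... | no c≢b   | false = ⊥-elim (noK (path-chord-no-new-virus G Nv v~a v~b Na a~c (not-¬ cb) a≢b
                             (saturated a b a≢b (⊢N⊆⇒≁ Na (∉-pair (~-irrefl v~b ∘ sym) (c≢b ∘ sym))))))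
    where Na = deg≡2⇒⊢N⊆ da (~-sym v~a) a~c (c∉v ∘ here ∘ sym)

  typeIV : 3 ≤ deg G a → 3 ≤ deg G b → G ⊢ a ~ b → TypeIV G v
  typeIV 3≤da 3≤db a~b = private-nbrs (nbr-∉ 3≤da) (nbr-∉ 3≤db)
    where
    witness : ∀ {a' b'} → G ⊢ a ~ a' → G ⊢ b ~ b' → a' ≢ b' →
              a' ∉ v ∷ b ∷ [] → b' ∉ v ∷ a ∷ [] → TypeIV G v
    witness a~a' b~b' a'≢b' a'∉ b'∉ =
      dv , a , b , nbhdIs Nv v~a v~b , 3≤da , 3≤db , a~b , _ , _ , a'≢b' ,
      a'∉ ∘ here , ~-irrefl a~a' ∘ sym , a'∉ ∘ there ∘ here ,
      b'∉ ∘ here , b'∉ ∘ there ∘ here , ~-irrefl b~b' ∘ sym , a~a' , b~b'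
    private-nbrs : (∃ λ a' → G ⊢ a ~ a' × a' ∉ v ∷ b ∷ []) →
                   (∃ λ b' → G ⊢ b ~ b' × b' ∉ v ∷ a ∷ []) → TypeIV G v
    private-nbrs (a' , a~a' , a'∉) (b' , b~b' , b'∉) with a' ≟ b'
    ... | no a'≢b' = witness a~a' b~b' a'≢b' a'∉ b'∉
    ... | yes refl with nbr-∉-or-⊢N⊆ a (v ∷ b ∷ a' ∷ []) | nbr-∉-or-⊢N⊆ b (v ∷ a ∷ a' ∷ [])
    ...   | inj₁ (a'' , a~a'' , a''∉) | _ =
      witness a~a'' b~b' (a''∉ ∘ there ∘ there ∘ here) (a''∉ ∘ ∈-++⁺ˡ) b'∉
    ...   | _ | inj₁ (b'' , b~b'' , b''∉) =
      witness a~a' b~b'' (b''∉ ∘ there ∘ there ∘ here ∘ sym) a'∉ (b''∉ ∘ ∈-++⁺ˡ)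
    ...   | inj₂ Na | inj₂ Nb =
      ⊥-elim (noK (K₄-completion-no-new-virus G Nv v~a v~b Na Nb a~a' b~b' v≢a' (saturated v a' v≢a' v≁a')))
      where
      v≢a' = a'∉ ∘ here ∘ sym
      v≁a' = ⊢N⊆⇒≁ Nv (∉-pair (~-irrefl a~a' ∘ sym) (a'∉ ∘ there ∘ here))

  typeIII-or-IV : 3 ≤ deg G a → 3 ≤ deg G b → TypeIII G v ⊎ TypeIV G v
  typeIII-or-IV 3≤da 3≤db with adj G a b in ab
  ... | false = inj₁ (dv , a , b , nbhdIs Nv v~a v~b , 3≤da , 3≤db , ab)
  ... | true  = inj₂ (typeIV 3≤da 3≤db ab)

lemma3p2 : (n : ℕ) (G : Graph n) → Connected G → K33Saturated G → 6 ≤ n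
    → (v : Fin n) → deg G v ≡ 2 → MinDegreeIs G 2
    → TypeI G v ⊎ TypeII G v ⊎ TypeIII G v ⊎ TypeIV G v
lemma3p2 n G conn (_ , noK , saturated) 6≤n v dv (_ , δ≥2)
  with a , b , v~a , v~b , a≢b ← Neighbourhoods.two-distinct-nbrs G {v} (≤-reflexive (sym dv))
  with m≤n⇒m<n∨m≡n (δ≥2 a) | m≤n⇒m<n∨m≡n (δ≥2 b)
... | inj₂ 2≡da | _         = [ inj₁ , inj₂ ∘ inj₁ ] (typeI-or-II conn (sym 2≡da))
  where open Degree2Vertex G 6≤n noK saturated δ≥2 dv v~a v~b a≢b
... | inj₁ _    | inj₂ 2≡db = [ inj₁ , inj₂ ∘ inj₁ ] (typeI-or-II conn (sym 2≡db))
  where open Degree2Vertex G 6≤n noK saturated δ≥2 dv v~b v~a (a≢b ∘ sym)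
... | inj₁ 3≤da | inj₁ 3≤db = inj₂ (inj₂ (typeIII-or-IV 3≤da 3≤db))
  where open Degree2Vertex G 6≤n noK saturated δ≥2 dv v~a v~b a≢b
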